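{- Let $\bm\lambda=(R_1,\dots,R_n)$ be a nesting minimal noncommuting path with $l(R_1)<l(R_n)$, $M_{1,n}=0$, and $R_1\leftrightarrow R_n$. Then $l(R_{t+1})=r(R_t)+1$ for every $1\le t\le n-1$.
   Context: A row is $R=a/b=\{(1,j):b+1\le j\le a\}$ ($a\ge b\ge0$ integers); $l(R)=b$, $r(R)=a-1$, $|R|$ its number of cells, $R^+=(a+1)/(b+1)$. For rows $R,R'$: $M(R,R')=|R\cap R'|$ if $l(R)\le l(R')$, else $|R\cap R'^+|$. Rows commute, $R\leftrightarrow R'$, if $M(R,R')=M(R',R)$, else $R\nleftrightarrow R'$. For a sequence of rows $(R_1,\dots,R_n)$: $M_{i,j}=M(R_{\min(i,j)},R_{\max(i,j)})$; $R_i\prec R_j$ means $M_{i,j}=|R_i|$. A noncommuting path is a sequence of $n\ge3$ rows with $R_t\nleftrightarrow R_{t+1}$ for all $1\le t\le n-1$; it is minimal if no subsequence $(R_1=R_{i_1},\dots,R_{i_k}=R_n)$ with $i_1<\dots<i_k$ and $3\le k<n$ is a noncommuting path. The sequence is nesting if for every $i<j$ either $M_{i,j}=0$, $R_i\prec R_j$, or $R_j\prec R_i$, and whenever $M_{i,j}=0$ we have $M_{i,k}+M_{j,k}\le|R_k|$ for every $k\notin\{i,j\}$. -}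

module Defs where

open import Data.Nat using (ℕ; zero; suc; _+_; _∸_; _≤_; _<_; _⊔_; _⊓_; _≤ᵇ_)
open import Data.Bool using (if_then_else_)
open import Data.Integer as ℤ using (ℤ; +_)
open import Data.Fin using (Fin; toℕ)
open import Data.Product using (_×_; Σ)
open import Data.Sum using (_⊎_)
open import Relation.Binary.PropositionalEquality using (_≡_; _≢_)
open import Relation.Nullary using (¬_)

-- A row a/b = {(1,j) : b+1 ≤ j ≤ a}, with a ≥ b ≥ 0.
record Row : Set where
  constructor _/_⟨_⟩
  field
    top : ℕ
    bot : ℕ
    bot≤top : bot ≤ top
open Row public

l : Row → ℕ
l R = bot R

-- r(R) = a - 1 (an integer; equals -1 for the empty row 0/0)
r : Row → ℤ
r R = + top R ℤ.- ℤ.1ℤ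

size : Row → ℕ
size R = top R ∸ bot R

-- |a/b ∩ a'/b'| = min(a,a') - max(b,b')
cap : ℕ → ℕ → ℕ → ℕ → ℕ
cap a b a' b' = (a ⊓ a') ∸ (b ⊔ b')

-- M(R,R') = |R ∩ R'| if l(R) ≤ l(R'), else |R ∩ R'^+| with R'^+ = (a'+1)/(b'+1)
M : Row → Row → ℕ
M R R' = if l R ≤ᵇ l R'
         then cap (top R) (bot R) (top R') (bot R')
         else cap (top R) (bot R) (suc (top R')) (suc (bot R'))

Commute : Row → Row → Set
Commute R R' = M R R' ≡ M R' R

-- sequences of rows (R_1,…,R_n) are functions Fin n → Row (0-based indices)
-- M_{i,j} = M(R_min(i,j), R_max(i,j))
Mseq : ∀ {n} → (Fin n → Row) → Fin n → Fin n → ℕ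
Mseq R i j = if toℕ i ≤ᵇ toℕ j then M (R i) (R j) else M (R j) (R i)

Prec : ∀ {n} → (Fin n → Row) → Fin n → Fin n → Set
Prec R i j = Mseq R i j ≡ size (R i)

NCPath : (n : ℕ) → (Fin n → Row) → Set
NCPath n R = (3 ≤ n) ×
  (∀ (t t' : Fin n) → toℕ t' ≡ suc (toℕ t) → ¬ Commute (R t) (R t'))

StrictlyIncreasing : ∀ {k n} → (Fin k → Fin n) → Set
StrictlyIncreasing ι = ∀ i j → toℕ i < toℕ j → toℕ (ι i) < toℕ (ι j)

MinimalNCPath : (n : ℕ) → (Fin n → Row) → Set
MinimalNCPath n R = NCPath n R ×
  (∀ (k : ℕ) (ι : Fin k → Fin n) → StrictlyIncreasing ι → 3 ≤ k → k < n →
     (∀ i → toℕ i ≡ 0 → toℕ (ι i) ≡ 0) →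
     (∀ i → suc (toℕ i) ≡ k → suc (toℕ (ι i)) ≡ n) →
     ¬ NCPath k (λ i → R (ι i)))

Nesting : (n : ℕ) → (Fin n → Row) → Set
Nesting n R = ∀ (i j : Fin n) → toℕ i < toℕ j →
  (Mseq R i j ≡ 0 ⊎ Prec R i j ⊎ Prec R j i) ×
  (Mseq R i j ≡ 0 → ∀ (k : Fin n) → k ≢ i → k ≢ j →
     Mseq R i k + Mseq R j k ≤ size (R k))

-- Rows R and S fail to commute exactly when one crosses the other, b < b' ≤ a < a'.
-- Minimality together with R_1 ↔ R_n makes all non-adjacent rows commute, and
-- nesting makes every forward crossing touch (b' = a) and constrains backward ones.
-- Along the maximal initial run of forward steps the rows form a staircase rising
-- to the right.  If the path ever steps backward, it is trapped from then on:
-- the right end of each later row is covered by an earlier row, which it cannot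
-- cross, and so the path can never reach R_n, which lies entirely to the right of
-- R_1.  Hence every step is a touching forward crossing, i.e. l(R_{t+1}) = r(R_t) + 1.
module Submission where

open import Defs
open import Data.Bool using (true; false; if_then_else_)
open import Data.Bool.Properties using (T-≡)
open import Data.Fin using (Fin; toℕ; fromℕ<)
open import Data.Fin.Properties using (toℕ<n; toℕ-fromℕ<; toℕ-injective)
open import Data.Integer as ℤ using (+_)
import Data.Integer.Properties as ℤ
open import Data.Nat
  using (ℕ; zero; suc; _+_; _∸_; _≤_; _<_; _⊓_; _≤ᵇ_; z≤n; s≤s; z<s; _≟_; _<?_; _≤?_)
open import Data.Nat.Properties
open import Data.Product using (_×_; _,_; proj₁; proj₂; ∃-syntax)
open import Data.Sum using (_⊎_; inj₁; inj₂; [_,_]′)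
open import Function using (_∘_; id)
open import Function.Bundles using (Equivalence)
open import Relation.Binary.Definitions using (tri<; tri≈; tri>)
open import Relation.Binary.PropositionalEquality
open import Relation.Nullary using (¬_; yes; no; contradiction)

open ≡-Reasoning

private variable
  i j k m n p q s t w : ℕ
  P Q R S : Row

≤ᵇ≡true : m ≤ n → (m ≤ᵇ n) ≡ true
≤ᵇ≡true m≤n = Equivalence.to T-≡ (≤⇒≤ᵇ m≤n)

≤ᵇ≡false : n < m → (m ≤ᵇ n) ≡ false
≤ᵇ≡false {n = n} {m = m} n<m with m ≤ᵇ n in eq
... | false = refl
... | true  = contradiction (≤ᵇ⇒≤ m n (Equivalence.from T-≡ eq)) (<⇒≱ n<m)

[m∸n]+[k∸m]≡k∸n : n ≤ m → m ≤ k → (m ∸ n) + (k ∸ m) ≡ k ∸ n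
[m∸n]+[k∸m]≡k∸n {n} {m} {k} n≤m m≤k = sym (begin
  k ∸ n                  ≡⟨ cong (_∸ n) (sym (m∸n+n≡m m≤k)) ⟩
  (k ∸ m + m) ∸ n        ≡⟨ +-∸-assoc (k ∸ m) n≤m ⟩
  (k ∸ m) + (m ∸ n)      ≡⟨ +-comm (k ∸ m) (m ∸ n) ⟩
  (m ∸ n) + (k ∸ m)      ∎)

+n≡[+n-1]+1 : ∀ n → + n ≡ (+ n ℤ.- ℤ.1ℤ) ℤ.+ ℤ.1ℤ
+n≡[+n-1]+1 n = sym (trans (ℤ.+-assoc (+ n) ℤ.-1ℤ ℤ.1ℤ) (ℤ.+-identityʳ (+ n)))

-- Crossing rows

M-bot≤ : ∀ R S → bot R ≤ bot S → M R S ≡ (top R ⊓ top S) ∸ bot S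
M-bot≤ _ _ bot≤bot rewrite ≤ᵇ≡true bot≤bot | m≤n⇒m⊔n≡n bot≤bot = refl

M-bot> : ∀ R S → bot S < bot R → M R S ≡ (top R ⊓ suc (top S)) ∸ bot R
M-bot> _ _ bot>bot rewrite ≤ᵇ≡false bot>bot | m≥n⇒m⊔n≡m bot>bot = refl

record Crosses (R S : Row) : Set where
  constructor crossing
  field
    bots    : bot R < bot S
    overlaps : bot S ≤ top R
    tops    : top R < top S
open Crosses public

M-crossing : Crosses R S → M R S ≡ top R ∸ bot S
M-crossing {R} {S} x =
  trans (M-bot≤ R S (<⇒≤ (bots x))) (cong (_∸ bot S) (m≤n⇒m⊓n≡m (<⇒≤ (tops x))))

M-crossed : Crosses S R → M R S ≡ suc (top S) ∸ bot R
M-crossed {S} {R} x = trans (M-bot> R S (bots x)) (cong (_∸ bot R) (m≥n⇒m⊓n≡n (tops x)))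

crossing⇒¬commute : Crosses R S → ¬ Commute R S
crossing⇒¬commute {R} {S} x R↔S = 1+n≢n (begin
  suc (top R ∸ bot S)  ≡⟨ sym (+-∸-assoc 1 (overlaps x)) ⟩
  suc (top R) ∸ bot S  ≡⟨ sym (M-crossed x) ⟩
  M S R                ≡⟨ sym R↔S ⟩
  M R S                ≡⟨ M-crossing x ⟩
  top R ∸ bot S        ∎)

crossed⇒¬commute : Crosses S R → ¬ Commute R S
crossed⇒¬commute x = crossing⇒¬commute x ∘ sym

module _ {R S : Row} (bot<bot : bot R < bot S) where

  commute-if-top<bot : top R < bot S → Commute R S
  commute-if-top<bot top<bot = begin
    M R S                          ≡⟨ M-bot≤ R S (<⇒≤ bot<bot) ⟩
    (top R ⊓ top S) ∸ bot S        ≡⟨ m≤n⇒m∸n≡0 (≤-trans (m⊓n≤m _ _) (<⇒≤ top<bot)) ⟩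
    0                              ≡⟨ sym (m≤n⇒m∸n≡0 (≤-trans (m⊓n≤n _ _) top<bot)) ⟩
    (top S ⊓ suc (top R)) ∸ bot S  ≡⟨ sym (M-bot> S R bot<bot) ⟩
    M S R                          ∎

  commute-if-top≤top : top S ≤ top R → Commute R S
  commute-if-top≤top top≤top = begin
    M R S                          ≡⟨ M-bot≤ R S (<⇒≤ bot<bot) ⟩
    (top R ⊓ top S) ∸ bot S        ≡⟨ cong (_∸ bot S) (m≥n⇒m⊓n≡n top≤top) ⟩
    top S ∸ bot S                  ≡⟨ cong (_∸ bot S) (sym (m≤n⇒m⊓n≡m (m≤n⇒m≤1+n top≤top))) ⟩
    (top S ⊓ suc (top R)) ∸ bot S  ≡⟨ sym (M-bot> S R bot<bot) ⟩
    M S R                          ∎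

  bot<∧¬commute⇒crossing : ¬ Commute R S → Crosses R S
  bot<∧¬commute⇒crossing R↮S = crossing bot<bot
    (≮⇒≥ (R↮S ∘ commute-if-top<bot)) (≰⇒> (R↮S ∘ commute-if-top≤top))

commute-if-bot≡ : ∀ R S → bot R ≡ bot S → Commute R S
commute-if-bot≡ R S bot≡bot = begin
  M R S                    ≡⟨ M-bot≤ R S (≤-reflexive bot≡bot) ⟩
  (top R ⊓ top S) ∸ bot S  ≡⟨ cong₂ _∸_ (⊓-comm (top R) (top S)) (sym bot≡bot) ⟩
  (top S ⊓ top R) ∸ bot R  ≡⟨ sym (M-bot≤ S R (≤-reflexive (sym bot≡bot))) ⟩
  M S R                    ∎

¬commute⇒crossing : ¬ Commute R S → Crosses R S ⊎ Crosses S R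
¬commute⇒crossing {R} {S} R↮S with <-cmp (bot R) (bot S)
... | tri< R<S _ _ = inj₁ (bot<∧¬commute⇒crossing R<S R↮S)
... | tri≈ _ R≡S _ = contradiction (commute-if-bot≡ R S R≡S) R↮S
... | tri> _ _ S<R = inj₂ (bot<∧¬commute⇒crossing S<R (R↮S ∘ sym))

¬commute⇒nonempty : ¬ Commute R S → bot S < top S
¬commute⇒nonempty {R} {S} R↮S =
  [ (λ x → ≤-<-trans (overlaps x) (tops x)) , (λ x → <-≤-trans (bots x) (overlaps x)) ]′
    (¬commute⇒crossing {R} {S} R↮S)

disjoint∧commute⇒top<bot :
  bot R < bot S → bot S < top S → M R S ≡ 0 → Commute R S → top R < bot S
disjoint∧commute⇒top<bot {R} {S} bot<bot nonempty M≡0 R↔S =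
  ≤∧≢⇒< top≤bot (λ top≡bot →
    crossing⇒¬commute (crossing {R} {S} bot<bot (≤-reflexive (sym top≡bot))
                                (subst (_< top S) (sym top≡bot) nonempty)) R↔S)
  where
  ⊓≤bot : top R ⊓ top S ≤ bot S
  ⊓≤bot = m∸n≡0⇒m≤n (trans (sym (M-bot≤ R S (<⇒≤ bot<bot))) M≡0)
  top≤bot : top R ≤ bot S
  top≤bot with ≤-total (top R) (top S)
  ... | inj₁ R≤S = subst (_≤ bot S) (m≤n⇒m⊓n≡m R≤S) ⊓≤bot
  ... | inj₂ S≤R = contradiction (subst (_≤ bot S) (m≥n⇒m⊓n≡n S≤R) ⊓≤bot) (<⇒≱ nonempty)

-- Nesting

-- The first clause of Nesting, for the pair R_i, R_j with i < j.
Nested : Row → Row → Set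
Nested R S = M R S ≡ 0 ⊎ M R S ≡ size R ⊎ M R S ≡ size S

crossing∧nested⇒touching : Crosses R S → Nested R S → bot S ≡ top R
crossing∧nested⇒touching x (inj₁ M≡0) =
  ≤-antisym (overlaps x) (m∸n≡0⇒m≤n (trans (sym (M-crossing x)) M≡0))
crossing∧nested⇒touching x (inj₂ (inj₁ M≡∣R∣)) =
  contradiction (trans (sym (M-crossing x)) M≡∣R∣) (<⇒≢ (∸-monoʳ-< (bots x) (overlaps x)))
crossing∧nested⇒touching x (inj₂ (inj₂ M≡∣S∣)) =
  contradiction (trans (sym (M-crossing x)) M≡∣S∣) (<⇒≢ (∸-monoˡ-< (tops x) (overlaps x)))

crossed∧nested⇒shifted : Crosses S R → Nested R S → top R ≡ suc (top S) ⊎ bot R ≡ suc (bot S)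
crossed∧nested⇒shifted x (inj₁ M≡0) =
  contradiction (m∸n≡0⇒m≤n (trans (sym (M-crossed x)) M≡0)) (<⇒≱ (s≤s (overlaps x)))
crossed∧nested⇒shifted x (inj₂ (inj₁ M≡∣R∣)) = inj₁ (sym (∸-cancelʳ-≡
  (m≤n⇒m≤1+n (overlaps x)) (≤-trans (overlaps x) (<⇒≤ (tops x))) (trans (sym (M-crossed x)) M≡∣R∣)))
crossed∧nested⇒shifted {S} x (inj₂ (inj₂ M≡∣S∣)) = inj₂ (∸-cancelˡ-≡ {o = suc (bot S)}
  (m≤n⇒m≤1+n (overlaps x)) (s≤s (≤-trans (<⇒≤ (bots x)) (overlaps x))) (trans (sym (M-crossed x)) M≡∣S∣))

touching⇒M≡0 : Crosses R S → bot S ≡ top R → M R S ≡ 0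
touching⇒M≡0 {R} x touch = trans (M-crossing x) (trans (cong (top R ∸_) touch) (n∸n≡0 (top R)))

touching-crossed⇒bot< :
  bot Q ≡ top P → Crosses S Q → M P S + M Q S ≤ size S → bot S < bot P
touching-crossed⇒bot< {Q} {P} {S} touch x bound =
  ≰⇒> (λ P≤S → 1+n≰n (subst (_≤ size S) (sum≡ P≤S) bound))
  where
  topP≤topS : top P ≤ top S
  topP≤topS = subst (_≤ top S) touch (overlaps x)
  botS≤topP : bot S ≤ top P
  botS≤topP = subst (bot S ≤_) touch (<⇒≤ (bots x))
  sum≡ : bot P ≤ bot S → M P S + M Q S ≡ suc (size S)
  sum≡ P≤S = begin
    M P S + M Q S
      ≡⟨ cong₂ _+_ (M-bot≤ P S P≤S) (M-crossed x) ⟩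
    (top P ⊓ top S) ∸ bot S + (suc (top S) ∸ bot Q)
      ≡⟨ cong₂ (λ c d → c ∸ bot S + (suc (top S) ∸ d)) (m≤n⇒m⊓n≡m topP≤topS) touch ⟩
    top P ∸ bot S + (suc (top S) ∸ top P)
      ≡⟨ cong (λ c → top P ∸ bot S + c) (+-∸-assoc 1 topP≤topS) ⟩
    top P ∸ bot S + suc (top S ∸ top P)
      ≡⟨ +-suc (top P ∸ bot S) (top S ∸ top P) ⟩
    suc (top P ∸ bot S + (top S ∸ top P))
      ≡⟨ cong suc ([m∸n]+[k∸m]≡k∸n botS≤topP topP≤topS) ⟩
    suc (top S ∸ bot S) ∎

crossed-touching⇒top< :
  Crosses Q P → bot S ≡ top Q → M P Q + M P S ≤ size P → top S < top P
crossed-touching⇒top< {Q} {P} {S} x touch bound =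
  ≰⇒> (λ P≤S → 1+n≰n (subst (_≤ size P) (sum≡ P≤S) bound))
  where
  botP≤botS : bot P ≤ bot S
  botP≤botS = subst (bot P ≤_) (sym touch) (overlaps x)
  sum≡ : top P ≤ top S → M P Q + M P S ≡ suc (size P)
  sum≡ P≤S = begin
    M P Q + M P S
      ≡⟨ cong₂ _+_ (M-crossed x) (M-bot≤ P S botP≤botS) ⟩
    suc (top Q) ∸ bot P + ((top P ⊓ top S) ∸ bot S)
      ≡⟨ cong₂ (λ c d → suc (top Q) ∸ bot P + (c ∸ d)) (m≤n⇒m⊓n≡m P≤S) touch ⟩
    suc (top Q) ∸ bot P + (top P ∸ top Q)
      ≡⟨ cong (_+ (top P ∸ top Q)) (+-∸-assoc 1 (overlaps x)) ⟩
    suc (top Q ∸ bot P + (top P ∸ top Q))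
      ≡⟨ cong suc ([m∸n]+[k∸m]≡k∸n (overlaps x) (<⇒≤ (tops x))) ⟩
    suc (top P ∸ bot P) ∎

last-nonempty : ∀ m (ρ : ℕ → Row) → (∀ t → t < m → ¬ Commute (ρ t) (ρ (suc t))) →
                0 < m → bot (ρ m) < top (ρ m)
last-nonempty (suc m) ρ adjacent-¬commute _ =
  ¬commute⇒nonempty {ρ m} {ρ (suc m)} (adjacent-¬commute m ≤-refl)

-- The staircase argument

-- nesting-ahead and nesting-behind are the second clause of Nesting for the triple t, t+1, t+2.
module Staircase
  (m : ℕ) (ρ : ℕ → Row)
  (adjacent-¬commute : ∀ t → t < m → ¬ Commute (ρ t) (ρ (suc t)))
  (distant-commute : ∀ i j → 2 + i ≤ j → j ≤ m → Commute (ρ i) (ρ j))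
  (adjacent-nested : ∀ t → t < m → Nested (ρ t) (ρ (suc t)))
  (nesting-ahead : ∀ t → 2 + t ≤ m → M (ρ t) (ρ (suc t)) ≡ 0 →
     M (ρ t) (ρ (2 + t)) + M (ρ (suc t)) (ρ (2 + t)) ≤ size (ρ (2 + t)))
  (nesting-behind : ∀ t → 2 + t ≤ m → M (ρ (suc t)) (ρ (2 + t)) ≡ 0 →
     M (ρ t) (ρ (suc t)) + M (ρ t) (ρ (2 + t)) ≤ size (ρ t))
  (bot₀<botₘ : bot (ρ 0) < bot (ρ m))
  (top₀<botₘ : top (ρ 0) < bot (ρ m))
  where

  b a : ℕ → ℕ
  b t = bot (ρ t)
  a t = top (ρ t)

  Forward Backward : ℕ → Set
  Forward t = Crosses (ρ t) (ρ (suc t))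
  Backward t = Crosses (ρ (suc t)) (ρ t)

  forward⊎backward : t < m → Forward t ⊎ Backward t
  forward⊎backward {t} t<m = ¬commute⇒crossing (adjacent-¬commute t t<m)

  ¬distant-crossing : 2 + i ≤ j → j ≤ m → ¬ Crosses (ρ i) (ρ j)
  ¬distant-crossing {i} {j} i+2≤j j≤m x = crossing⇒¬commute x (distant-commute i j i+2≤j j≤m)

  ¬distant-crossed : 2 + i ≤ j → j ≤ m → ¬ Crosses (ρ j) (ρ i)
  ¬distant-crossed {i} {j} i+2≤j j≤m x = crossed⇒¬commute x (distant-commute i j i+2≤j j≤m)

  forward⇒touching : t < m → Forward t → b (suc t) ≡ a t
  forward⇒touching {t} t<m fw = crossing∧nested⇒touching fw (adjacent-nested t t<m)

  backward⇒shifted : t < m → Backward t → a t ≡ suc (a (suc t)) ⊎ b t ≡ suc (b (suc t))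
  backward⇒shifted {t} t<m bw = crossed∧nested⇒shifted bw (adjacent-nested t t<m)

  forward-backward⇒bot< : 2 + t ≤ m → Forward t → Backward (suc t) → b (2 + t) < b t
  forward-backward⇒bot< {t} t+2≤m fw bw =
    touching-crossed⇒bot< {P = ρ t} touch bw (nesting-ahead t t+2≤m (touching⇒M≡0 fw touch))
    where touch = forward⇒touching (m+n≤o⇒n≤o 1 t+2≤m) fw

  backward-forward⇒top< : 2 + t ≤ m → Backward t → Forward (suc t) → a (2 + t) < a t
  backward-forward⇒top< {t} t+2≤m bw fw =
    crossed-touching⇒top< {S = ρ (2 + t)} bw touch (nesting-behind t t+2≤m (touching⇒M≡0 fw touch))
    where touch = forward⇒touching t+2≤m fw

  AllForward : ℕ → Set
  AllForward v = ∀ k → k < v → Forward k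

  allForward-pred : AllForward (suc k) → AllForward k
  allForward-pred fw j j<k = fw j (m<n⇒m<1+n j<k)

  bot₀≤bot : ∀ k → AllForward k → b 0 ≤ b k
  bot₀≤bot zero    _  = ≤-refl
  bot₀≤bot (suc k) fw = ≤-trans (bot₀≤bot k (allForward-pred fw)) (<⇒≤ (bots (fw k ≤-refl)))

  ends-left-of-staircase : ∀ {z} k → AllForward k → 2 + k ≤ z → z ≤ m →
                           b z < b 0 → a z < a k → a z < b 0
  ends-left-of-staircase {z} k fw k+2≤z z≤m bz<b₀ az<ak with a z <? b k
  ... | no az≮bk = contradiction
    (crossing (<-≤-trans bz<b₀ (bot₀≤bot k fw)) (≮⇒≥ az≮bk) az<ak) (¬distant-crossed k+2≤z z≤m)
  ends-left-of-staircase zero    _  _ _ _ _ | yes az<bk = az<bk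
  ends-left-of-staircase {z} (suc k) fw k+3≤z z≤m bz<b₀ _ | yes az<bk =
    ends-left-of-staircase k (allForward-pred fw) k+2≤z z≤m bz<b₀
      (subst (a z <_) (forward⇒touching (m+n≤o⇒n≤o 1 (≤-trans k+2≤z z≤m)) (fw k ≤-refl)) az<bk)
    where k+2≤z = m+n≤o⇒n≤o 1 k+3≤z

  starts-left-of-staircase : ∀ {z} k → AllForward k → 2 + k ≤ z → z ≤ m →
                             b z ≤ a k → a k < a z → b z ≤ b 0
  starts-left-of-staircase {z} k fw k+2≤z z≤m bz≤ak ak<az with b k <? b z
  ... | yes bk<bz = contradiction (crossing bk<bz bz≤ak ak<az) (¬distant-crossing k+2≤z z≤m)
  starts-left-of-staircase zero    _  _ _ _ _ | no bk≮bz = ≮⇒≥ bk≮bz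
  starts-left-of-staircase {z} (suc k) fw k+3≤z z≤m _ ak<az | no bk≮bz =
    starts-left-of-staircase k (allForward-pred fw) k+2≤z z≤m
      (subst (b z ≤_) (forward⇒touching (m+n≤o⇒n≤o 1 (≤-trans k+2≤z z≤m)) fwk) (≮⇒≥ bk≮bz))
      (<-trans (tops fwk) ak<az)
    where
    k+2≤z = m+n≤o⇒n≤o 1 k+3≤z
    fwk = fw k ≤-refl

  backward-after-staircase : ∀ w → 2 + w ≤ m → AllForward (suc w) → Backward (suc w) →
                             b (2 + w) ≤ b 0
  backward-after-staircase zero    w+2≤m fw bw = <⇒≤ (forward-backward⇒bot< w+2≤m (fw 0 z<s) bw)
  backward-after-staircase (suc w) w+3≤m fw bw =
    starts-left-of-staircase w (allForward-pred (allForward-pred fw)) (n≤1+n _) w+3≤m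
      (<⇒≤ (subst (b (3 + w) <_) (forward⇒touching (m+n≤o⇒n≤o 2 w+3≤m) fw₀)
                         (forward-backward⇒bot< w+3≤m fw₁ bw)))
      (<-≤-trans (tops fw₀)
        (subst (_≤ a (3 + w)) (forward⇒touching (m+n≤o⇒n≤o 1 w+3≤m) fw₁) (overlaps bw)))
    where
    fw₀ = fw w (n≤1+n _)
    fw₁ = fw (suc w) ≤-refl

  ¬forward-backward-forward : 3 + w ≤ m → Forward w → Backward (suc w) → ¬ Forward (2 + w)
  ¬forward-backward-forward {w} w+3≤m fw₀ bw fw₂
    with backward⇒shifted (m+n≤o⇒n≤o 1 w+3≤m) bw
  ... | inj₁ a₁≡1+a₂ = <⇒≱ (tops fw₂)
          (≤-pred (subst (a (3 + w) <_) a₁≡1+a₂ (backward-forward⇒top< w+3≤m bw fw₂)))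
  ... | inj₂ b₁≡1+b₂ = <⇒≢
          (≤-<-trans (forward-backward⇒bot< (m+n≤o⇒n≤o 1 w+3≤m) fw₀ bw) (bots fw₀)) (sym b₁≡1+b₂)

  -- From s₀ on the path is trapped below Y: either the right end of the current row is
  -- covered by an earlier row ending below W, which a forward step may not cross, or the
  -- last step was backward, which bounds the next forward step by backward-forward⇒top<.
  module Trap (s₀ Y W : ℕ) (Y≤W : Y ≤ W)
    (bounded : ∀ s → s₀ ≤ s → suc s ≤ m → Forward s → a s < Y → a (suc s) < W → a (suc s) < Y)
    where

    Covered : ℕ → Set
    Covered s = ∃[ u ] u < s × b u < a s × a s ≤ a u × a u < W

    AfterBackward : ℕ → Set
    AfterBackward s = ∃[ p ] s ≡ suc p × Backward p × a p < W

    Trapped : ℕ → Set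
    Trapped s = a s < Y × (Covered s ⊎ AfterBackward s)

    covered⇒<W : Covered s → a s < W
    covered⇒<W (_ , _ , _ , as≤au , au<W) = ≤-<-trans as≤au au<W

    covered-forward : suc s ≤ m → Forward s → Covered s → Covered (suc s)
    covered-forward {s} s<m fw (u , u<s , bu<as , as≤au , au<W) =
      u , m<n⇒m<1+n u<s , <-trans bu<as (tops fw) , ≮⇒≥ escapes , au<W
      where
      escapes : ¬ a u < a (suc s)
      escapes au<a₁ = ¬distant-crossing (s≤s u<s) s<m (crossing
        (subst (b u <_) (sym touch) bu<as) (subst (_≤ a u) (sym touch) as≤au) au<a₁)
        where touch = forward⇒touching s<m fw

    afterBackward-forward : suc s ≤ m → Forward s → AfterBackward s → Covered (suc s)
    afterBackward-forward s<m fw (p , refl , bw , ap<W) =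
      p , n≤1+n _ , ≤-<-trans (overlaps bw) (tops fw) , <⇒≤ (backward-forward⇒top< s<m bw fw) , ap<W

    trapped-suc : s₀ ≤ s → suc s ≤ m → Trapped s → Trapped (suc s)
    trapped-suc {s} s₀≤s s<m (as<Y , history) with forward⊎backward s<m
    ... | inj₂ bw = <-trans (tops bw) as<Y , inj₂ (s , refl , bw , <-≤-trans as<Y Y≤W)
    ... | inj₁ fw = bounded s s₀≤s s<m fw as<Y (covered⇒<W covered) , inj₁ covered
      where covered = [ covered-forward s<m fw , afterBackward-forward s<m fw ]′ history

    trapped : Trapped s₀ → s₀ ≤ s → s ≤ m → Trapped s
    trapped {s} start s₀≤s s≤m with m≤n⇒m<n∨m≡n s₀≤s
    trapped         start _ _   | inj₂ refl = start
    trapped {suc s} start _ s<m | inj₁ s₀<1+s =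
      trapped-suc (≤-pred s₀<1+s) s<m (trapped start (≤-pred s₀<1+s) (<⇒≤ s<m))

  ¬backward₀ : 0 < m → ¬ Backward 0
  ¬backward₀ 0<m bw =
    <⇒≱ (<-≤-trans top₀<botₘ (bot≤top (ρ m))) (≤-pred (proj₁ (trapped start 0<m ≤-refl)))
    where
    open Trap 1 (suc (a 0)) (suc (a 0)) ≤-refl (λ _ _ _ _ _ → id)
    start : Trapped 1
    start = s≤s (<⇒≤ (tops bw)) , inj₂ (0 , refl , bw , ≤-refl)

  ¬staircase-backward-backward :
    3 + w ≤ m → AllForward (suc w) → Backward (suc w) → ¬ Backward (2 + w)
  ¬staircase-backward-backward {w} w+3≤m fw bw₁ bw₂ =
    <⇒≱ (<-≤-trans bot₀<botₘ (bot≤top (ρ m))) (<⇒≤ (proj₁ (trapped start w+3≤m ≤-refl)))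
    where
    b₂≤b₀ : b (2 + w) ≤ b 0
    b₂≤b₀ = backward-after-staircase w (m+n≤o⇒n≤o 1 w+3≤m) fw bw₁
    b₀≤a₁ : b 0 ≤ a (suc w)
    b₀≤a₁ = ≤-trans (bot₀≤bot (suc w) fw) (≤-trans (overlaps bw₁) (<⇒≤ (tops bw₁)))
    bounded : ∀ s → 3 + w ≤ s → suc s ≤ m → Forward s →
              a s < b 0 → a (suc s) < a (suc w) → a (suc s) < b 0
    bounded s w+3≤s s<m fw' as<b₀ =
      ends-left-of-staircase (suc w) fw (m≤n⇒m≤1+n w+3≤s) s<m
        (subst (_< b 0) (sym (forward⇒touching s<m fw')) as<b₀)
    open Trap (3 + w) (b 0) (a (suc w)) b₀≤a₁ bounded
    start : Trapped (3 + w)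
    start = ends-left-of-staircase (suc w) fw ≤-refl w+3≤m
              (<-≤-trans (bots bw₂) b₂≤b₀) (<-trans (tops bw₂) (tops bw₁))
          , inj₂ (2 + w , refl , bw₂ , tops bw₁)

  ¬first-backward : ∀ v → v < m → AllForward v → ¬ Backward v
  ¬first-backward zero    0<m _  = ¬backward₀ 0<m
  ¬first-backward (suc w) v<m fw bw with m≤n⇒m<n∨m≡n v<m
  ... | inj₂ w+2≡m = <⇒≱ bot₀<botₘ
          (subst (λ k → b k ≤ b 0) w+2≡m (backward-after-staircase w v<m fw bw))
  ... | inj₁ w+2<m with forward⊎backward w+2<m
  ...   | inj₁ fw₂ = ¬forward-backward-forward w+2<m (fw w ≤-refl) bw fw₂
  ...   | inj₂ bw₂ = ¬staircase-backward-backward w+2<m fw bw bw₂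

  allForward : ∀ v → v ≤ m → AllForward v
  allForward zero    _   _ ()
  allForward (suc v) v<m k k<1+v with m≤n⇒m<n∨m≡n (≤-pred k<1+v)
  ... | inj₁ k<v = allForward v (<⇒≤ v<m) k k<v
  ... | inj₂ refl = [ id , (λ bw → contradiction bw
                      (¬first-backward k v<m (allForward k (<⇒≤ v<m)))) ]′ (forward⊎backward v<m)

  adjacent-touching : ∀ t → t < m → b (suc t) ≡ a t
  adjacent-touching t t<m = forward⇒touching t<m (allForward (suc t) t<m t ≤-refl)

-- Paths indexed by ℕ

Mseq-≤ : (R : Fin n → Row) {i j : Fin n} → toℕ i ≤ toℕ j → Mseq R i j ≡ M (R i) (R j)
Mseq-≤ R i≤j rewrite ≤ᵇ≡true i≤j = refl

Mseq-> : (R : Fin n → Row) {i j : Fin n} → toℕ j < toℕ i → Mseq R i j ≡ M (R j) (R i)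
Mseq-> R j<i rewrite ≤ᵇ≡false j<i = refl

clamp : ℕ → Fin (suc m)
clamp {m} k = fromℕ< (s≤s (m⊓n≤n k m))

toℕ-clamp : k ≤ m → toℕ (clamp {m} k) ≡ k
toℕ-clamp k≤m = trans (toℕ-fromℕ< _) (m≤n⇒m⊓n≡m k≤m)

module Sequence {m : ℕ} (R : Fin (suc m) → Row) where

  -- Indices beyond m are clamped to m; those values are never used.
  ρ : ℕ → Row
  ρ = R ∘ clamp

  ρ-toℕ : ∀ i → ρ (toℕ i) ≡ R i
  ρ-toℕ i = cong R (toℕ-injective (toℕ-clamp (≤-pred (toℕ<n i))))

  ρ-at : {i : Fin (suc m)} → toℕ i ≡ k → ρ k ≡ R i
  ρ-at {i = i} refl = ρ-toℕ i

  clamp-≤ : i ≤ j → j ≤ m → toℕ (clamp {m} i) ≤ toℕ (clamp {m} j)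
  clamp-≤ i≤j j≤m rewrite toℕ-clamp (≤-trans i≤j j≤m) | toℕ-clamp j≤m = i≤j

  clamp-< : i < j → j ≤ m → toℕ (clamp {m} i) < toℕ (clamp {m} j)
  clamp-< i<j j≤m rewrite toℕ-clamp (<⇒≤ (<-≤-trans i<j j≤m)) | toℕ-clamp j≤m = i<j

  Mseq-clamp : i ≤ j → j ≤ m → Mseq R (clamp i) (clamp j) ≡ M (ρ i) (ρ j)
  Mseq-clamp i≤j j≤m = Mseq-≤ R (clamp-≤ i≤j j≤m)

  Mseq-clamp-swap : i < j → j ≤ m → Mseq R (clamp j) (clamp i) ≡ M (ρ i) (ρ j)
  Mseq-clamp-swap i<j j≤m = Mseq-> R (clamp-< i<j j≤m)

  clamp-≢ : i ≤ m → j ≤ m → i ≢ j → clamp {m} i ≢ clamp j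
  clamp-≢ i≤m j≤m i≢j eq = i≢j (trans (sym (toℕ-clamp i≤m)) (trans (cong toℕ eq) (toℕ-clamp j≤m)))

  module _ (nesting : Nesting (suc m) R) where

    nested : i < j → j ≤ m → Nested (ρ i) (ρ j)
    nested {i} {j} i<j j≤m with proj₁ (nesting (clamp i) (clamp j) (clamp-< i<j j≤m))
    ... | inj₁ M≡0        = inj₁ (trans (sym (Mseq-clamp (<⇒≤ i<j) j≤m)) M≡0)
    ... | inj₂ (inj₁ i≺j) = inj₂ (inj₁ (trans (sym (Mseq-clamp (<⇒≤ i<j) j≤m)) i≺j))
    ... | inj₂ (inj₂ j≺i) = inj₂ (inj₂ (trans (sym (Mseq-clamp-swap i<j j≤m)) j≺i))

    disjoint-bound : i < j → j ≤ m → k ≤ m → k ≢ i → k ≢ j → M (ρ i) (ρ j) ≡ 0 →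
      Mseq R (clamp i) (clamp k) + Mseq R (clamp j) (clamp k) ≤ size (ρ k)
    disjoint-bound {i} {j} {k} i<j j≤m k≤m k≢i k≢j M≡0 =
      proj₂ (nesting (clamp i) (clamp j) (clamp-< i<j j≤m))
        (trans (Mseq-clamp (<⇒≤ i<j) j≤m) M≡0) (clamp k)
        (clamp-≢ k≤m i≤m k≢i) (clamp-≢ k≤m j≤m k≢j)
      where i≤m = <⇒≤ (<-≤-trans i<j j≤m)

    nesting-ahead : ∀ t → 2 + t ≤ m → M (ρ t) (ρ (suc t)) ≡ 0 →
      M (ρ t) (ρ (2 + t)) + M (ρ (suc t)) (ρ (2 + t)) ≤ size (ρ (2 + t))
    nesting-ahead t t+2≤m M≡0 =
      subst₂ (λ c d → c + d ≤ size (ρ (2 + t)))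
        (Mseq-clamp (m≤n⇒m≤1+n (n≤1+n t)) t+2≤m) (Mseq-clamp (n≤1+n (suc t)) t+2≤m)
        (disjoint-bound ≤-refl (m+n≤o⇒n≤o 1 t+2≤m) t+2≤m (λ ()) (λ ()) M≡0)

    nesting-behind : ∀ t → 2 + t ≤ m → M (ρ (suc t)) (ρ (2 + t)) ≡ 0 →
      M (ρ t) (ρ (suc t)) + M (ρ t) (ρ (2 + t)) ≤ size (ρ t)
    nesting-behind t t+2≤m M≡0 =
      subst₂ (λ c d → c + d ≤ size (ρ t))
        (Mseq-clamp-swap ≤-refl (m+n≤o⇒n≤o 1 t+2≤m)) (Mseq-clamp-swap (m<n⇒m<1+n ≤-refl) t+2≤m)
        (disjoint-bound ≤-refl t+2≤m (≤-trans (n≤1+n t) (m+n≤o⇒n≤o 1 t+2≤m)) (λ ()) (λ ()) M≡0)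

  adjacent-¬commute : NCPath (suc m) R → ∀ t → t < m → ¬ Commute (ρ t) (ρ (suc t))
  adjacent-¬commute (_ , ¬commute) t t<m = ¬commute (clamp t) (clamp (suc t))
    (trans (toℕ-clamp t<m) (cong suc (sym (toℕ-clamp (<⇒≤ t<m)))))

  -- The subpath dropping the e + 1 rows strictly between R_i and R_j, j = i + e + 2,
  -- with f rows after R_j; it has ℓ = i + f + 2 rows.
  module Shortcut (i e f : ℕ) (m≡ : m ≡ suc i + f + suc e) where

    ℓ : ℕ
    ℓ = suc (suc i + f)

    skip : ℕ → ℕ
    skip p = if p ≤ᵇ i then p else p + suc e

    skip-≤ : p ≤ i → skip p ≡ p
    skip-≤ p≤i rewrite ≤ᵇ≡true p≤i = refl

    skip-> : i < p → skip p ≡ p + suc e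
    skip-> i<p rewrite ≤ᵇ≡false i<p = refl

    i≤m : i ≤ m
    i≤m = subst (i ≤_) (sym m≡) (≤-trans (n≤1+n i) (≤-trans (m≤m+n (suc i) f) (m≤m+n _ (suc e))))

    skip-bounded : p < ℓ → skip p ≤ m
    skip-bounded {p} p<ℓ with p ≤? i
    ... | yes p≤i = subst (_≤ m) (sym (skip-≤ p≤i)) (≤-trans p≤i i≤m)
    ... | no  p≰i = subst₂ _≤_ (sym (skip-> (≰⇒> p≰i))) (sym m≡) (+-monoˡ-≤ (suc e) (≤-pred p<ℓ))

    skip-< : p < q → skip p < skip q
    skip-< {p} {q} p<q with p ≤? i | q ≤? i
    ... | yes p≤i | yes q≤i = subst₂ _<_ (sym (skip-≤ p≤i)) (sym (skip-≤ q≤i)) p<q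
    ... | yes p≤i | no  q≰i =
      subst₂ _<_ (sym (skip-≤ p≤i)) (sym (skip-> (≰⇒> q≰i))) (<-≤-trans p<q (m≤m+n q (suc e)))
    ... | no  p≰i | yes q≤i = contradiction (≤-trans (<⇒≤ p<q) q≤i) p≰i
    ... | no  p≰i | no  q≰i =
      subst₂ _<_ (sym (skip-> (≰⇒> p≰i))) (sym (skip-> (≰⇒> q≰i))) (+-monoˡ-< (suc e) p<q)

    ι : Fin ℓ → Fin (suc m)
    ι p = clamp (skip (toℕ p))

    toℕ-ι : ∀ p → toℕ (ι p) ≡ skip (toℕ p)
    toℕ-ι p = toℕ-clamp (skip-bounded (toℕ<n p))

    module _ (adjacent : ∀ t → t < m → ¬ Commute (ρ t) (ρ (suc t)))
             (i↮j : ¬ Commute (ρ i) (ρ (suc i + suc e))) where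

      shortcut-¬commute : ∀ p → suc p < ℓ → ¬ Commute (ρ (skip p)) (ρ (skip (suc p)))
      shortcut-¬commute p p+1<ℓ with <-cmp p i
      ... | tri< p<i _ _ = subst₂ (λ c d → ¬ Commute (ρ c) (ρ d))
              (sym (skip-≤ (<⇒≤ p<i))) (sym (skip-≤ p<i)) (adjacent p (<-≤-trans p<i i≤m))
      ... | tri≈ _ refl _ = subst₂ (λ c d → ¬ Commute (ρ c) (ρ d))
              (sym (skip-≤ ≤-refl)) (sym (skip-> ≤-refl)) i↮j
      ... | tri> _ _ i<p = subst₂ (λ c d → ¬ Commute (ρ c) (ρ d))
              (sym (skip-> i<p)) (sym (skip-> (m<n⇒m<1+n i<p)))
              (adjacent (p + suc e) (subst (suc p + suc e ≤_) (sym m≡) (+-monoˡ-≤ (suc e) (≤-pred p+1<ℓ))))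

      ¬minimal : 0 < i + f → ¬ MinimalNCPath (suc m) R
      ¬minimal 0<i+f (_ , minimal) = minimal ℓ ι increasing 3≤ℓ ℓ<1+m first last (3≤ℓ , path)
        where
        3≤ℓ : 3 ≤ ℓ
        3≤ℓ = s≤s (s≤s 0<i+f)
        ℓ<1+m : ℓ < suc m
        ℓ<1+m = s≤s (subst (ℓ ≤_) (sym m≡) (m<m+n (suc i + f) z<s))
        increasing : StrictlyIncreasing ι
        increasing p q p<q = subst₂ _<_ (sym (toℕ-ι p)) (sym (toℕ-ι q)) (skip-< p<q)
        first : ∀ p → toℕ p ≡ 0 → toℕ (ι p) ≡ 0
        first p p≡0 = trans (toℕ-ι p) (trans (cong skip p≡0) (skip-≤ z≤n))
        last : ∀ p → suc (toℕ p) ≡ ℓ → suc (toℕ (ι p)) ≡ suc m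
        last p p+1≡ℓ = cong suc (trans (toℕ-ι p) (trans (cong skip (suc-injective p+1≡ℓ))
                         (trans (skip-> (s≤s (m≤m+n i f))) (sym m≡))))
        path : ∀ p p′ → toℕ p′ ≡ suc (toℕ p) → ¬ Commute (R (ι p)) (R (ι p′))
        path p p′ p′≡p+1 = subst (λ c → ¬ Commute (ρ (skip (toℕ p))) (ρ (skip c))) (sym p′≡p+1)
          (shortcut-¬commute (toℕ p) (subst (_< ℓ) p′≡p+1 (toℕ<n p′)))

  distant-commute : MinimalNCPath (suc m) R → Commute (ρ 0) (ρ m) →
                    ∀ i j → 2 + i ≤ j → j ≤ m → Commute (ρ i) (ρ j)
  distant-commute minimal ends i j i+2≤j j≤m with M (ρ i) (ρ j) ≟ M (ρ j) (ρ i)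
  ... | yes i↔j = i↔j
  ... | no  i↮j with 0 <? i + (m ∸ j)
  ...   | yes 0<i+f = contradiction minimal
          (Shortcut.¬minimal i e f m≡ (adjacent-¬commute (proj₁ minimal))
             (subst (λ c → ¬ Commute (ρ i) (ρ c)) (sym j≡) i↮j) 0<i+f)
    where
    e = j ∸ (2 + i)
    f = m ∸ j
    j≡ : suc i + suc e ≡ j
    j≡ = trans (cong suc (+-suc i e)) (m+[n∸m]≡n i+2≤j)
    m≡ : m ≡ suc i + f + suc e
    m≡ = begin
      m                    ≡⟨ sym (m+[n∸m]≡n j≤m) ⟩
      j + f                ≡⟨ cong (_+ f) (sym j≡) ⟩
      suc i + suc e + f    ≡⟨ +-assoc (suc i) (suc e) f ⟩
      suc i + (suc e + f)  ≡⟨ cong (λ c → suc i + c) (+-comm (suc e) f) ⟩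
      suc i + (f + suc e)  ≡⟨ sym (+-assoc (suc i) f (suc e)) ⟩
      suc i + f + suc e    ∎
  -- Only for i = 0, j = m is the shortcut too short to contradict minimality.
  ...   | no ¬0<i+f = contradiction (subst₂ (λ c d → Commute (ρ c) (ρ d)) (sym i≡0) m≡j ends) i↮j
    where
    i+f≡0 = n≤0⇒n≡0 (≮⇒≥ ¬0<i+f)
    i≡0 = m+n≡0⇒m≡0 i i+f≡0
    m≡j = ≤-antisym (m∸n≡0⇒m≤n (m+n≡0⇒n≡0 i i+f≡0)) j≤m

proposition5p51 : (n : ℕ) (R : Fin n → Row) →
    Nesting n R → MinimalNCPath n R →
    (first last : Fin n) → toℕ first ≡ 0 → suc (toℕ last) ≡ n →
    l (R first) < l (R last) → Mseq R first last ≡ 0 →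
    Commute (R first) (R last) →
    ∀ (t t' : Fin n) → toℕ t' ≡ suc (toℕ t) →
      + l (R t') ≡ r (R t) ℤ.+ ℤ.1ℤ
proposition5p51 zero R _ _ ()
proposition5p51 (suc m) R nesting minimal first last first≡0 last≡m bot< M≡0 first↔last t t′ t′≡t+1 =
  begin
    + l (R t′)               ≡⟨ cong (+_ ∘ bot) (sym (ρ-at t′≡t+1)) ⟩
    + bot (ρ (suc (toℕ t)))  ≡⟨ cong +_ (adjacent-touching (toℕ t) t<m) ⟩
    + top (ρ (toℕ t))        ≡⟨ cong (+_ ∘ top) (ρ-toℕ t) ⟩
    + top (R t)              ≡⟨ +n≡[+n-1]+1 (top (R t)) ⟩
    r (R t) ℤ.+ ℤ.1ℤ         ∎
  where
  open Sequence R
  ρ₀ = ρ-at first≡0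
  ρₘ = ρ-at (suc-injective last≡m)
  adjacent = adjacent-¬commute (proj₁ minimal)
  ends : Commute (ρ 0) (ρ m)
  ends = subst₂ Commute (sym ρ₀) (sym ρₘ) first↔last
  bot₀<botₘ : bot (ρ 0) < bot (ρ m)
  bot₀<botₘ = subst₂ (λ c d → bot c < bot d) (sym ρ₀) (sym ρₘ) bot<
  M₀ₘ≡0 : M (ρ 0) (ρ m) ≡ 0
  M₀ₘ≡0 = subst₂ (λ c d → M c d ≡ 0) (sym ρ₀) (sym ρₘ)
    (trans (sym (Mseq-≤ R (subst (_≤ toℕ last) (sym first≡0) z≤n))) M≡0)
  top₀<botₘ : top (ρ 0) < bot (ρ m)
  top₀<botₘ = disjoint∧commute⇒top<bot {ρ 0} {ρ m} bot₀<botₘ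
    (last-nonempty m ρ adjacent (m+n≤o⇒n≤o 1 (≤-pred (proj₁ (proj₁ minimal))))) M₀ₘ≡0 ends
  t<m : toℕ t < m
  t<m = ≤-pred (subst (_< suc m) t′≡t+1 (toℕ<n t′))
  open Staircase m ρ adjacent (distant-commute minimal ends) (λ t → nested nesting (n<1+n t))
         (nesting-ahead nesting) (nesting-behind nesting) bot₀<botₘ top₀<botₘ
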